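{- Let $G=(V,E)$ be a graph of maximum degree at most $d$ and suppose $q\ge d+1$. Let $X$ be a uniformly random proper $q$-coloring of $G$, with $X_v$ the color of $v$. Then for all distinct $u,v\in V$ with $\{u,v\}\notin E$, $\Pr[X_u=X_v]\ge\frac{1}{q(d+1)^3}$. -}

module Defs where

open import Data.Nat using (ℕ; zero; suc; _≤_)
open import Data.Fin using (Fin)
open import Data.Fin.Properties using (_≟_; all?)
open import Data.Bool using (Bool; true; false)
open import Data.List using (List; []; _∷_; [_]; map; concatMap; filter; length; allFin)
open import Data.Vec using (Vec; lookup) renaming ([] to []ᵥ; _∷_ to _∷ᵥ_)
open import Relation.Binary.PropositionalEquality using (_≡_; _≢_)
open import Relation.Nullary using (Dec; yes; no; ¬_)
open import Relation.Nullary.Decidable using (_→-dec_; ¬?)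
open import Data.Bool.Properties renaming (_≟_ to _≟ᵇ_)

record Graph (n : ℕ) : Set where
  field
    adj   : Fin n → Fin n → Bool
    sym   : ∀ u v → adj u v ≡ adj v u
    irrefl : ∀ v → adj v v ≡ false
open Graph public

Adj : ∀ {n} → Graph n → Fin n → Fin n → Set
Adj G u v = adj G u v ≡ true

adj? : ∀ {n} (G : Graph n) u v → Dec (Adj G u v)
adj? G u v = adj G u v ≟ᵇ true

degree : ∀ {n} → Graph n → Fin n → ℕ
degree {n} G v = length (filter (adj? G v) (allFin n))

MaxDegree≤ : ∀ {n} → Graph n → ℕ → Set
MaxDegree≤ {n} G d = ∀ (v : Fin n) → degree G v ≤ d

Proper : ∀ {n q} → Graph n → Vec (Fin q) n → Set
Proper {n} G X = ∀ (u v : Fin n) → Adj G u v → lookup X u ≢ lookup X v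

proper? : ∀ {n q} (G : Graph n) (X : Vec (Fin q) n) → Dec (Proper G X)
proper? G X = all? λ u → all? λ v → adj? G u v →-dec ¬? (lookup X u ≟ lookup X v)

allColourings : (q n : ℕ) → List (Vec (Fin q) n)
allColourings q zero = [ []ᵥ ]
allColourings q (suc n) = concatMap (λ c → map (c ∷ᵥ_) (allColourings q n)) (allFin q)

properColourings : ∀ {n} (G : Graph n) (q : ℕ) → List (Vec (Fin q) n)
properColourings {n} G q = filter (proper? G) (allColourings q n)

numProper : ∀ {n} → Graph n → ℕ → ℕ
numProper G q = length (properColourings G q)

numProperSame : ∀ {n} → Graph n → (q : ℕ) → Fin n → Fin n → ℕ
numProperSame G q u v =
  length (filter (λ X → lookup X u ≟ lookup X v) (properColourings G q))

-- A proper colouring X is sent to a proper colouring Y with Y u = Y v: give u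
-- and v a common colour c, and give the only neighbour w of u or v of colour c
-- (if there is one) a colour missing from its at most d < q neighbours. If at
-- most one neighbour of v has colour X u, take c = X u. Otherwise, as u and v
-- have at most 2d < 2q neighbours, some colour c occurs at most once among
-- them, and X u survives in Y as the colour of a neighbour of v. X is recovered
-- from Y, the old colour of v, the vertex w (if any) and u or a neighbour of v
-- carrying the old colour of u: at most q (d+1)(2d+1) ≤ q (d+1)³ choices.
module Submission where

open import Defs hiding (sym)
open import Data.Nat using (ℕ; zero; suc; _+_; _*_; _^_; _≤_; _<_; z≤n; s≤s; _≤?_)
open import Data.Nat.Properties
  using (≤-trans; ≤-reflexive; ≤-pred; n≤1+n; +-mono-≤; +-monoʳ-≤; *-mono-≤; *-monoʳ-≤; m≤m*n; *-comm;
         *-identityʳ; +-identityʳ; +-suc; ≰⇒>; <⇒≱; module ≤-Reasoning)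
open import Data.Nat.Tactic.RingSolver using (solve-∀)
open import Data.Fin using (Fin; zero; suc)
open import Data.Fin.Properties using (_≟_; ¬∀⟶∃¬)
open import Data.Bool using (true; false)
open import Data.Maybe using (Maybe; nothing; just)
open import Data.Maybe.Properties using (just-injective)
open import Data.Product using (∃; _×_; _,_; proj₁; proj₂; uncurry)
open import Data.Sum using (_⊎_; inj₁; inj₂; [_,_]′)
import Data.Sum as Sum
open import Data.Empty using (⊥-elim)
open import Data.List
  using (List; []; _∷_; _++_; map; concatMap; filter; length; allFin; head; cartesianProduct;
         cartesianProductWith)
open import Data.List.Properties using (length-++; length-map; length-tabulate; length-removeAt′; filter-some)
open import Data.List.Membership.Propositional using (_∈_; _─_; lose)
open import Data.List.Membership.Propositional.Properties
  using (∈-map⁺; ∈-filter⁺; ∈-filter⁻; ∈-++⁺ˡ; ∈-++⁺ʳ; ∈-++⁻; ∈-allFin; ∈-concatMap⁺;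
         ∈-cartesianProductWith⁺; ∈-cartesianProduct⁺)
open import Data.List.Relation.Binary.Subset.Propositional using (_⊆_)
open import Data.List.Relation.Unary.Any using (here; there; index)
import Data.List.Relation.Unary.All as All
open import Data.List.Relation.Unary.AllPairs using ([]; _∷_)
open import Data.List.Relation.Unary.Unique.Propositional using (Unique)
import Data.List.Relation.Unary.Unique.Propositional.Properties as Unique
open import Data.Vec using (Vec; lookup; _[_]≔_) renaming ([] to []ᵥ; _∷_ to _∷ᵥ_)
open import Data.Vec.Properties
  using (∷-injective; lookup∘update; lookup∘update′; []≔-commutes; []≔-idempotent; []≔-lookup)
open import Function using (_∘_; id)
open import Relation.Binary.PropositionalEquality
  using (_≡_; _≢_; refl; sym; trans; cong; cong₂; subst; module ≡-Reasoning)
open import Relation.Nullary using (¬_; yes; no; does)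
open import Relation.Unary using (Pred; Decidable; ∅)
open import Level using (0ℓ)

private
  variable
    A B C : Set

∈-─ : ∀ {x y : A} {xs} (x∈xs : x ∈ xs) → y ∈ xs → y ≢ x → y ∈ xs ─ x∈xs
∈-─ (here refl)  (here refl)  y≢x = ⊥-elim (y≢x refl)
∈-─ (here _)     (there y∈xs) _   = y∈xs
∈-─ (there _)    (here refl)  _   = here refl
∈-─ (there x∈xs) (there y∈xs) y≢x = there (∈-─ x∈xs y∈xs y≢x)

Unique-⊆⇒length≤ : ∀ {xs ys : List A} → Unique xs → xs ⊆ ys → length xs ≤ length ys
Unique-⊆⇒length≤ {xs = []}     _              _     = z≤n
Unique-⊆⇒length≤ {xs = x ∷ xs} {ys} (x∉xs ∷ xs!) xs⊆ys = begin
  suc (length xs)          ≤⟨ s≤s (Unique-⊆⇒length≤ xs! xs⊆ys─x) ⟩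
  suc (length (ys ─ x∈ys)) ≡⟨ length-removeAt′ ys (index x∈ys) ⟨
  length ys                ∎
  where
  open ≤-Reasoning
  x∈ys = xs⊆ys (here refl)
  xs⊆ys─x : xs ⊆ ys ─ x∈ys
  xs⊆ys─x y∈xs = ∈-─ x∈ys (xs⊆ys (there y∈xs)) (All.lookup x∉xs y∈xs ∘ sym)

length-concatMap≤ : ∀ (f : A → List B) {k} → (∀ x → length (f x) ≤ k) →
                    ∀ xs → length (concatMap f xs) ≤ length xs * k
length-concatMap≤ f _   []       = z≤n
length-concatMap≤ f f≤k (x ∷ xs) = begin
  length (f x ++ concatMap f xs)          ≡⟨ length-++ (f x) ⟩
  length (f x) + length (concatMap f xs)  ≤⟨ +-mono-≤ (f≤k x) (length-concatMap≤ f f≤k xs) ⟩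
  _ + length xs * _                       ∎
  where open ≤-Reasoning

length-cartesianProductWith : ∀ (f : A → B → C) xs ys →
  length (cartesianProductWith f xs ys) ≡ length xs * length ys
length-cartesianProductWith f []       ys = refl
length-cartesianProductWith f (x ∷ xs) ys = begin
  length (map (f x) ys ++ cartesianProductWith f xs ys)
    ≡⟨ length-++ (map (f x) ys) ⟩
  length (map (f x) ys) + length (cartesianProductWith f xs ys)
    ≡⟨ cong₂ _+_ (length-map (f x) ys) (length-cartesianProductWith f xs ys) ⟩
  length ys + length xs * length ys ∎
  where open ≡-Reasoning

concatMap-map≡cartesianProductWith : ∀ (f : A → B → C) xs ys →
  concatMap (λ x → map (f x) ys) xs ≡ cartesianProductWith f xs ys
concatMap-map≡cartesianProductWith f []       ys = refl
concatMap-map≡cartesianProductWith f (x ∷ xs) ys =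
  cong (map (f x) ys ++_) (concatMap-map≡cartesianProductWith f xs ys)

length-filter-map : ∀ {p} {P : Pred B p} (P? : Decidable P) (f : A → B) xs →
                    length (filter P? (map f xs)) ≡ length (filter (P? ∘ f) xs)
length-filter-map P? f []       = refl
length-filter-map P? f (x ∷ xs) with does (P? (f x))
... | true  = cong suc (length-filter-map P? f xs)
... | false = length-filter-map P? f xs

∃-∈ : ∀ {xs : List A} → 0 < length xs → ∃ (_∈ xs)
∃-∈ {xs = x ∷ _} _ = x , here refl

head≡just⇒∈ : ∀ {x} (xs : List A) → head xs ≡ just x → x ∈ xs
head≡just⇒∈ (_ ∷ _) refl = here refl

∈⇒head≡just : ∀ {x} {xs : List A} → length xs ≤ 1 → x ∈ xs → head xs ≡ just x
∈⇒head≡just                   _        (here refl)   = refl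
∈⇒head≡just {xs = _ ∷ []}     _        (there ())
∈⇒head≡just {xs = _ ∷ _ ∷ _}  (s≤s ()) (there _)

maybes : List A → List (Maybe A)
maybes xs = nothing ∷ map just xs

length-maybes : (xs : List A) → length (maybes xs) ≡ suc (length xs)
length-maybes xs = cong suc (length-map just xs)

head∈maybes : ∀ {xs ys : List A} → xs ⊆ ys → head xs ∈ maybes ys
head∈maybes {xs = []}    _     = here refl
head∈maybes {xs = _ ∷ _} xs⊆ys = there (∈-map⁺ just (xs⊆ys (here refl)))

1+2n≤[1+n]² : ∀ n → suc (n + n) ≤ suc n * suc n
1+2n≤[1+n]² n = s≤s (+-monoʳ-≤ n (m≤m*n n (suc n)))

-- Pigeonhole principle with multiplicities

occurrences : ∀ {q} → Fin q → List (Fin q) → ℕ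
occurrences c cs = length (filter (_≟ c) cs)

dropZeros : ∀ {q} → List (Fin (suc q)) → List (Fin q)
dropZeros []           = []
dropZeros (zero  ∷ cs) = dropZeros cs
dropZeros (suc c ∷ cs) = c ∷ dropZeros cs

length-dropZeros : ∀ {q} (cs : List (Fin (suc q))) →
                   length cs ≡ occurrences zero cs + length (dropZeros cs)
length-dropZeros []           = refl
length-dropZeros (zero  ∷ cs) = cong suc (length-dropZeros cs)
length-dropZeros (suc c ∷ cs) =
  trans (cong suc (length-dropZeros cs)) (sym (+-suc (occurrences zero cs) _))

occurrences-dropZeros : ∀ {q} (c : Fin q) cs → occurrences (suc c) cs ≡ occurrences c (dropZeros cs)
occurrences-dropZeros c []            = refl
occurrences-dropZeros c (zero   ∷ cs) = occurrences-dropZeros c cs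
occurrences-dropZeros c (suc c′ ∷ cs) with does (c′ ≟ c)
... | true  = cong suc (occurrences-dropZeros c cs)
... | false = occurrences-dropZeros c cs

≤-occurrences⇒*≤length : ∀ {q} k (cs : List (Fin q)) → (∀ c → k ≤ occurrences c cs) → q * k ≤ length cs
≤-occurrences⇒*≤length {zero}  k cs _      = z≤n
≤-occurrences⇒*≤length {suc q} k cs k≤occ = begin
  k + q * k                                 ≤⟨ +-mono-≤ (k≤occ zero) q*k≤rest ⟩
  occurrences zero cs + length (dropZeros cs) ≡⟨ length-dropZeros cs ⟨
  length cs                                 ∎
  where
  open ≤-Reasoning
  q*k≤rest = ≤-occurrences⇒*≤length k (dropZeros cs)
               (λ c → subst (k ≤_) (occurrences-dropZeros c cs) (k≤occ (suc c)))

pigeonhole : ∀ {q k} (f : A → Fin q) xs → length xs < q * k →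
             ∃ λ c → length (filter (λ x → f x ≟ c) xs) < k
pigeonhole {q = q} {k} f xs xs<qk = c , ≰⇒> k≰
  where
  open ≤-Reasoning
  q*k≤length : (∀ c → k ≤ length (filter (λ x → f x ≟ c) xs)) → q * k ≤ length xs
  q*k≤length k≤ = begin
    q * k            ≤⟨ ≤-occurrences⇒*≤length k (map f xs)
                          (λ c → subst (k ≤_) (sym (length-filter-map (_≟ c) f xs)) (k≤ c)) ⟩
    length (map f xs) ≡⟨ length-map f xs ⟩
    length xs        ∎
  c,k≰ = ¬∀⟶∃¬ q _ (λ c → k ≤? length (filter (λ x → f x ≟ c) xs)) (<⇒≱ xs<qk ∘ q*k≤length)
  c   = proj₁ c,k≰
  k≰  = proj₂ c,k≰

missing-colour : ∀ {q} (f : A → Fin q) xs → length xs < q → ∃ λ c → ∀ {x} → x ∈ xs → f x ≢ c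
missing-colour {q = q} f xs xs<q = c , λ x∈xs fx≡c →
  <⇒≱ none (filter-some (λ x → f x ≟ c) (lose x∈xs fx≡c))
  where
  c,none = pigeonhole {k = 1} f xs (subst (length xs <_) (sym (*-identityʳ q)) xs<q)
  c      = proj₁ c,none
  none   = proj₂ c,none

[]≔-restore₂ : ∀ {n} (xs : Vec A n) {i j} → i ≢ j → ∀ a b →
  (((xs [ i ]≔ a) [ j ]≔ b) [ i ]≔ lookup xs i) [ j ]≔ lookup xs j ≡ xs
[]≔-restore₂ xs {i} {j} i≢j a b = begin
  (((xs [ i ]≔ a) [ j ]≔ b) [ i ]≔ xᵢ) [ j ]≔ xⱼ
    ≡⟨ cong (_[ j ]≔ xⱼ) ([]≔-commutes (xs [ i ]≔ a) j i (i≢j ∘ sym)) ⟩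
  (((xs [ i ]≔ a) [ i ]≔ xᵢ) [ j ]≔ b) [ j ]≔ xⱼ
    ≡⟨ []≔-idempotent ((xs [ i ]≔ a) [ i ]≔ xᵢ) j ⟩
  ((xs [ i ]≔ a) [ i ]≔ xᵢ) [ j ]≔ xⱼ
    ≡⟨ cong (_[ j ]≔ xⱼ) (trans ([]≔-idempotent xs i) ([]≔-lookup xs i)) ⟩
  xs [ j ]≔ xⱼ
    ≡⟨ []≔-lookup xs j ⟩
  xs ∎
  where
  open ≡-Reasoning
  xᵢ = lookup xs i
  xⱼ = lookup xs j

∈-allColourings : ∀ {q n} (X : Vec (Fin q) n) → X ∈ allColourings q n
∈-allColourings []ᵥ = here refl
∈-allColourings {q} {suc n} (c ∷ᵥ X)
  rewrite concatMap-map≡cartesianProductWith _∷ᵥ_ (allFin q) (allColourings q n)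
  = ∈-cartesianProductWith⁺ _∷ᵥ_ (∈-allFin c) (∈-allColourings X)

allColourings-unique : ∀ q n → Unique (allColourings q n)
allColourings-unique q zero    = All.[] ∷ []
allColourings-unique q (suc n)
  rewrite concatMap-map≡cartesianProductWith _∷ᵥ_ (allFin q) (allColourings q n)
  = Unique.cartesianProductWith⁺ _∷ᵥ_ ∷-injective (Unique.allFin⁺ q) (allColourings-unique q n)

module _ {n} (G : Graph n) where

  neighbours : Fin n → List (Fin n)
  neighbours a = filter (adj? G a) (allFin n)

  ∈-neighbours⁺ : ∀ {a t} → Adj G a t → t ∈ neighbours a
  ∈-neighbours⁺ {a} {t} = ∈-filter⁺ (adj? G a) (∈-allFin t)

  ∈-neighbours⁻ : ∀ {a t} → t ∈ neighbours a → Adj G a t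
  ∈-neighbours⁻ {a} t∈ = proj₂ (∈-filter⁻ (adj? G a) {xs = allFin n} t∈)

  Adj-sym : ∀ {a b} → Adj G a b → Adj G b a
  Adj-sym {a} {b} = trans (sym (Graph.sym G a b))

  Adj-irrefl : ∀ {a} → ¬ Adj G a a
  Adj-irrefl {a} aa with trans (sym (irrefl G a)) aa
  ... | ()

  properColourings-unique : ∀ q → Unique (properColourings G q)
  properColourings-unique q = Unique.filter⁺ (proper? G) (allColourings-unique q n)

  ProperOff : ∀ {q} → Vec (Fin q) n → Pred (Fin n) 0ℓ → Set
  ProperOff X W = ∀ s t → Adj G s t → ¬ W s → ¬ W t → lookup X s ≢ lookup X t

  Proper⇒ProperOff : ∀ {q W} (X : Vec (Fin q) n) → Proper G X → ProperOff X W
  Proper⇒ProperOff _ X-proper s t st _ _ = X-proper s t st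

  ProperOff⇒Proper : ∀ {q W} (X : Vec (Fin q) n) → (∀ t → ¬ W t) → ProperOff X W → Proper G X
  ProperOff⇒Proper _ W-empty X-ok s t st = X-ok s t st (W-empty s) (W-empty t)

  []≔-properOff : ∀ {q W W′} (X : Vec (Fin q) n) (a : Fin n) (α : Fin q) →
                  ProperOff X W → (∀ s → W s → W′ s ⊎ s ≡ a) →
                  (∀ t → Adj G a t → ¬ W′ t → lookup X t ≢ α) → ProperOff (X [ a ]≔ α) W′
  []≔-properOff {W = W} {W′} X a α X-ok W⊆W′+a fresh s t st ¬W′s ¬W′t with s ≟ a | t ≟ a
  ... | yes refl | yes refl = ⊥-elim (Adj-irrefl st)
  ... | yes refl | no t≢a rewrite lookup∘update s X α | lookup∘update′ t≢a X α =
    fresh t st ¬W′t ∘ sym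
  ... | no s≢a | yes refl rewrite lookup∘update′ s≢a X α | lookup∘update t X α =
    fresh s (Adj-sym st) ¬W′s
  ... | no s≢a | no t≢a rewrite lookup∘update′ s≢a X α | lookup∘update′ t≢a X α =
    X-ok s t st (outside s≢a ¬W′s) (outside t≢a ¬W′t)
    where
    outside : ∀ {r} → r ≢ a → ¬ W′ r → ¬ W r
    outside r≢a ¬W′r Wr = [ ¬W′r , r≢a ]′ (W⊆W′+a _ Wr)

-- Merging the colours of two non-adjacent vertices

module SameColour {n} (G : Graph n) {d q : ℕ} (maxDeg : MaxDegree≤ G d) (d<q : suc d ≤ q)
                  {u v : Fin n} (u≢v : u ≢ v) (u≁v : ¬ Adj G u v) where

  Colouring : Set
  Colouring = Vec (Fin q) n

  near : List (Fin n)
  near = neighbours G u ++ neighbours G v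

  near⁻ : ∀ {t} → t ∈ near → Adj G u t ⊎ Adj G v t
  near⁻ = Sum.map (∈-neighbours⁻ G) (∈-neighbours⁻ G) ∘ ∈-++⁻ (neighbours G u)

  near⇒≢u : ∀ {t} → t ∈ near → t ≢ u
  near⇒≢u t∈near refl = [ Adj-irrefl G , u≁v ∘ Adj-sym G ]′ (near⁻ t∈near)

  near⇒≢v : ∀ {t} → t ∈ near → t ≢ v
  near⇒≢v t∈near refl = [ u≁v , Adj-irrefl G ]′ (near⁻ t∈near)

  length-near≤ : length near ≤ d + d
  length-near≤ = ≤-trans (≤-reflexive (length-++ (neighbours G u))) (+-mono-≤ (maxDeg u) (maxDeg v))

  length-near<2q : length near < q * 2
  length-near<2q = begin-strict
    length near                         ≤⟨ length-near≤ ⟩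
    d + d                               <⟨ +-mono-≤ d<q (≤-trans (n≤1+n d) d<q) ⟩
    q + q                               ≡⟨ cong (q +_) (+-identityʳ q) ⟨
    2 * q                               ≡⟨ *-comm 2 q ⟩
    q * 2                               ∎
    where open ≤-Reasoning

  conflicts : Colouring → Fin q → List (Fin n)
  conflicts X c = filter (λ t → lookup X t ≟ c) near

  conflicts⊆near : ∀ X c → conflicts X c ⊆ near
  conflicts⊆near X c t∈ = proj₁ (∈-filter⁻ (λ t → lookup X t ≟ c) {xs = near} t∈)

  -- Inverse of the recolouring: u and v get α and β, and the recoloured vertex
  -- w gets back its old colour, the common colour of u and v in Y.
  restore : Colouring → Fin q → Fin q → Maybe (Fin n) → Colouring
  restore Y α β nothing  = (Y [ u ]≔ α) [ v ]≔ β
  restore Y α β (just w) = ((Y [ u ]≔ α) [ v ]≔ β) [ w ]≔ lookup Y u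

  record Recolouring (X : Colouring) (c : Fin q) (mw : Maybe (Fin n)) : Set where
    field
      colouring : Colouring
      proper    : Proper G colouring
      at-u      : lookup colouring u ≡ c
      at-v      : lookup colouring v ≡ c
      restores  : restore colouring (lookup X u) (lookup X v) mw ≡ X
      agrees    : ∀ t → t ≢ u → t ≢ v → lookup X t ≢ c → lookup colouring t ≡ lookup X t

  module Paint (X : Colouring) (X-proper : Proper G X) (c : Fin q) {mw : Maybe (Fin n)}
               (conflict⇒mw : ∀ t → t ∈ near → lookup X t ≡ c → mw ≡ just t) where

    Z : Colouring
    Z = (X [ u ]≔ c) [ v ]≔ c

    Z-u : lookup Z u ≡ c
    Z-u = trans (lookup∘update′ u≢v (X [ u ]≔ c) c) (lookup∘update u X c)

    Z-v : lookup Z v ≡ c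
    Z-v = lookup∘update v (X [ u ]≔ c) c

    Z-elsewhere : ∀ {t} → t ≢ u → t ≢ v → lookup Z t ≡ lookup X t
    Z-elsewhere t≢u t≢v = trans (lookup∘update′ t≢v (X [ u ]≔ c) c) (lookup∘update′ t≢u X c)

    Z-restore : (Z [ u ]≔ lookup X u) [ v ]≔ lookup X v ≡ X
    Z-restore = []≔-restore₂ X u≢v c c

    Z-properOff : ProperOff G Z (λ t → mw ≡ just t)
    Z-properOff =
      []≔-properOff G (X [ u ]≔ c) v c
        ([]≔-properOff G X u c (Proper⇒ProperOff G X X-proper) (λ _ → inj₁) fresh-u)
        (λ _ → inj₁) fresh-v
      where
      fresh-u : ∀ t → Adj G u t → mw ≢ just t → lookup X t ≢ c
      fresh-u t ut mw≢t = mw≢t ∘ conflict⇒mw t (∈-++⁺ˡ (∈-neighbours⁺ G ut))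
      fresh-v : ∀ t → Adj G v t → mw ≢ just t → lookup (X [ u ]≔ c) t ≢ c
      fresh-v t vt mw≢t Xt≡c = mw≢t (conflict⇒mw t t∈near
        (trans (sym (lookup∘update′ (near⇒≢u t∈near) X c)) Xt≡c))
        where t∈near = ∈-++⁺ʳ (neighbours G u) (∈-neighbours⁺ G vt)

  paint : ∀ X → Proper G X → ∀ c mw →
          (∀ t → t ∈ near → lookup X t ≡ c → mw ≡ just t) →
          (∀ w → mw ≡ just w → w ∈ near × lookup X w ≡ c) → Recolouring X c mw
  paint X X-proper c nothing conflict⇒mw _ = record
    { colouring = Z
    ; proper    = ProperOff⇒Proper G Z (λ _ ()) Z-properOff
    ; at-u      = Z-u
    ; at-v      = Z-v
    ; restores  = Z-restore
    ; agrees    = λ t t≢u t≢v _ → Z-elsewhere t≢u t≢v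
    }
    where open Paint X X-proper c conflict⇒mw
  paint X X-proper c (just w) conflict⇒mw mw⇒conflict = record
    { colouring = Y
    ; proper    = Y-proper
    ; at-u      = Y-u
    ; at-v      = trans (lookup∘update′ (w≢v ∘ sym) Z c′) Z-v
    ; restores  = Y-restores
    ; agrees    = Y-agrees
    }
    where
    open Paint X X-proper c conflict⇒mw
    w∈near = proj₁ (mw⇒conflict w refl)
    Xw≡c   = proj₂ (mw⇒conflict w refl)
    w≢u    = near⇒≢u w∈near
    w≢v    = near⇒≢v w∈near

    c′,fresh = missing-colour (lookup Z) (neighbours G w) (≤-trans (s≤s (maxDeg w)) d<q)
    c′       = proj₁ c′,fresh

    Y : Colouring
    Y = Z [ w ]≔ c′

    Y-proper : Proper G Y
    Y-proper = ProperOff⇒Proper G Y (λ _ ()) ([]≔-properOff G {W′ = ∅} Z w c′ Z-properOff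
      (λ _ w≡s → inj₂ (sym (just-injective w≡s)))
      (λ t wt _ → proj₂ c′,fresh (∈-neighbours⁺ G wt)))

    Y-u : lookup Y u ≡ c
    Y-u = trans (lookup∘update′ (w≢u ∘ sym) Z c′) Z-u

    Y-restores : restore Y (lookup X u) (lookup X v) (just w) ≡ X
    Y-restores = begin
      (((Z [ w ]≔ c′) [ u ]≔ xu) [ v ]≔ xv) [ w ]≔ lookup Y u
        ≡⟨ cong (((Z [ w ]≔ c′) [ u ]≔ xu) [ v ]≔ xv [ w ]≔_) Y-u ⟩
      (((Z [ w ]≔ c′) [ u ]≔ xu) [ v ]≔ xv) [ w ]≔ c
        ≡⟨ cong (λ Z′ → (Z′ [ v ]≔ xv) [ w ]≔ c) ([]≔-commutes Z w u w≢u) ⟩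
      (((Z [ u ]≔ xu) [ w ]≔ c′) [ v ]≔ xv) [ w ]≔ c
        ≡⟨ cong (_[ w ]≔ c) ([]≔-commutes (Z [ u ]≔ xu) w v w≢v) ⟩
      (((Z [ u ]≔ xu) [ v ]≔ xv) [ w ]≔ c′) [ w ]≔ c
        ≡⟨ []≔-idempotent ((Z [ u ]≔ xu) [ v ]≔ xv) w ⟩
      ((Z [ u ]≔ xu) [ v ]≔ xv) [ w ]≔ c
        ≡⟨ cong (_[ w ]≔ c) Z-restore ⟩
      X [ w ]≔ c
        ≡⟨ cong (X [ w ]≔_) Xw≡c ⟨
      X [ w ]≔ lookup X w
        ≡⟨ []≔-lookup X w ⟩
      X ∎
      where
      open ≡-Reasoning
      xu = lookup X u
      xv = lookup X v

    Y-agrees : ∀ t → t ≢ u → t ≢ v → lookup X t ≢ c → lookup Y t ≡ lookup X t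
    Y-agrees t t≢u t≢v Xt≢c = trans (lookup∘update′ t≢w Z c′) (Z-elsewhere t≢u t≢v)
      where
      t≢w : t ≢ w
      t≢w refl = Xt≢c Xw≡c

  merge : ∀ X → Proper G X → ∀ c → length (conflicts X c) ≤ 1 → Recolouring X c (head (conflicts X c))
  merge X X-proper c few = paint X X-proper c (head (conflicts X c))
    (λ t t∈near Xt≡c → ∈⇒head≡just few (∈-filter⁺ (λ t → lookup X t ≟ c) t∈near Xt≡c))
    (λ w eq → ∈-filter⁻ (λ t → lookup X t ≟ c) {xs = near} (head≡just⇒∈ (conflicts X c) eq))

  candidates : Colouring → List Colouring
  candidates Y = cartesianProductWith (λ α → uncurry (restore Y α))
                   (map (lookup Y) (u ∷ neighbours G v))
                   (cartesianProduct (allFin q) (maybes near))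

  restore∈candidates : ∀ Y {α} β {mw} → α ∈ map (lookup Y) (u ∷ neighbours G v) → mw ∈ maybes near →
                       restore Y α β mw ∈ candidates Y
  restore∈candidates Y β α∈ mw∈ =
    ∈-cartesianProductWith⁺ (λ α → uncurry (restore Y α)) α∈ (∈-cartesianProduct⁺ (∈-allFin β) mw∈)

  length-candidates : ∀ Y → length (candidates Y) ≤ q * suc d ^ 3
  length-candidates Y = begin
    length (candidates Y)
      ≡⟨ length-cartesianProductWith (λ α → uncurry (restore Y α)) (map (lookup Y) (u ∷ neighbours G v))
                                   (cartesianProduct (allFin q) (maybes near)) ⟩
    length (map (lookup Y) (u ∷ neighbours G v)) * length (cartesianProduct (allFin q) (maybes near))
      ≡⟨ cong₂ _*_ (length-map (lookup Y) (u ∷ neighbours G v))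
                   (length-cartesianProductWith _,_ (allFin q) (maybes near)) ⟩
    suc (degree G v) * (length (allFin q) * length (maybes near))
      ≡⟨ cong (λ m → suc (degree G v) * m) (cong₂ _*_ (length-tabulate {n = q} id) (length-maybes near)) ⟩
    suc (degree G v) * (q * suc (length near))
      ≤⟨ *-mono-≤ (s≤s (maxDeg v)) (*-monoʳ-≤ q (s≤s length-near≤)) ⟩
    suc d * (q * suc (d + d))
      ≤⟨ *-monoʳ-≤ (suc d) (*-monoʳ-≤ q (1+2n≤[1+n]² d)) ⟩
    suc d * (q * (suc d * suc d))
      ≡⟨ rearrange d q ⟩
    q * suc d ^ 3 ∎
    where
    open ≤-Reasoning
    rearrange : ∀ d q → suc d * (q * (suc d * suc d)) ≡ q * (suc d * (suc d * (suc d * 1)))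
    rearrange = solve-∀

  reachable : ∀ X → Proper G X → ∃ λ Y → Proper G Y × lookup Y u ≡ lookup Y v × X ∈ candidates Y
  reachable X X-proper with length (conflicts X (lookup X u)) ≤? 1
  ... | yes few = colouring , proper , trans at-u (sym at-v) ,
    subst (_∈ candidates colouring) restores
      (restore∈candidates colouring (lookup X v) (here (sym at-u))
        (head∈maybes (conflicts⊆near X (lookup X u))))
    where open Recolouring (merge X X-proper (lookup X u) few)
  ... | no many = colouring , proper , trans at-u (sym at-v) ,
    subst (_∈ candidates colouring) restores
      (restore∈candidates colouring (lookup X v) (there Xu∈)
        (head∈maybes (conflicts⊆near X c)))
    where
    c,few = pigeonhole (lookup X) near length-near<2q
    c     = proj₁ c,few
    open Recolouring (merge X X-proper c (≤-pred (proj₂ c,few)))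

    -- A neighbour x of v with X x = X u ≠ c keeps its colour in Y.
    x,x∈ = ∃-∈ (≤-trans (s≤s z≤n) (≰⇒> many))
    x    = proj₁ x,x∈
    x∈near = proj₁ (∈-filter⁻ (λ t → lookup X t ≟ lookup X u) {xs = near} (proj₂ x,x∈))
    Xx≡Xu  = proj₂ (∈-filter⁻ (λ t → lookup X t ≟ lookup X u) {xs = near} (proj₂ x,x∈))

    x∈Nv : x ∈ neighbours G v
    x∈Nv = [ (λ ux → ⊥-elim (X-proper u x ux (sym Xx≡Xu))) , ∈-neighbours⁺ G ]′ (near⁻ x∈near)

    Xu≢c : lookup X u ≢ c
    Xu≢c Xu≡c = many (subst (λ c′ → length (conflicts X c′) ≤ 1) (sym Xu≡c) (≤-pred (proj₂ c,few)))

    Yx≡Xu : lookup colouring x ≡ lookup X u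
    Yx≡Xu = trans (agrees x (near⇒≢u x∈near) (near⇒≢v x∈near) (Xu≢c ∘ trans (sym Xx≡Xu))) Xx≡Xu

    Xu∈ : lookup X u ∈ map (lookup colouring) (neighbours G v)
    Xu∈ = subst (_∈ map (lookup colouring) (neighbours G v)) Yx≡Xu (∈-map⁺ (lookup colouring) x∈Nv)

  properColourings⊆candidates :
    properColourings G q ⊆ concatMap candidates (filter (λ Y → lookup Y u ≟ lookup Y v) (properColourings G q))
  properColourings⊆candidates {X} X∈ with reachable X (proj₂ (∈-filter⁻ (proper? G) {xs = allColourings q n} X∈))
  ... | Y , Y-proper , Yu≡Yv , X∈cands =
    ∈-concatMap⁺ candidates (lose (∈-filter⁺ (λ Y → lookup Y u ≟ lookup Y v)
                                     (∈-filter⁺ (proper? G) (∈-allColourings Y) Y-proper) Yu≡Yv)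
                                  X∈cands)

lemma6 : ∀ {n} (G : Graph n) (d q : ℕ) → MaxDegree≤ G d → suc d ≤ q →
         (u v : Fin n) → u ≢ v → ¬ Adj G u v →
         numProper G q ≤ q * (suc d ^ 3) * numProperSame G q u v
lemma6 G d q maxDeg d<q u v u≢v u≁v = begin
  numProper G q                                 ≤⟨ Unique-⊆⇒length≤ (properColourings-unique G q)
                                                                     properColourings⊆candidates ⟩
  length (concatMap candidates sameColoured)    ≤⟨ length-concatMap≤ candidates length-candidates sameColoured ⟩
  numProperSame G q u v * (q * suc d ^ 3)       ≡⟨ *-comm (numProperSame G q u v) _ ⟩
  q * suc d ^ 3 * numProperSame G q u v         ∎
  where
  open ≤-Reasoning
  open SameColour G maxDeg d<q u≢v u≁v
  sameColoured = filter (λ Y → lookup Y u ≟ lookup Y v) (properColourings G q)
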